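{- There exists an oracle $D$ such that (the set $D$, which lies in $\mathrm{P}^D$) $D$ is not $D$-scalable and $\mathrm{census}_D\notin\mathrm{FP}^D$.
   Context: Strings are over $\Sigma=\{0,1\}$, with $\le$ the standard lexicographic order. $\mathrm{census}_D(1^n)=|\{x\in D:|x|=n\}|$. A set is rankable in $\mathrm{FP}^X$ if its ranking function $x\mapsto|\{y\le x:y\in$ set$\}|$ is computable by a deterministic polynomial-time oracle transducer with oracle $X$. A $\mathrm{P}^X$-isomorphism is a bijection $\phi:\Sigma^*\to\Sigma^*$ with $\phi,\phi^{ -1}\in\mathrm{FP}^X$. A set is $X$-scalable if there is a $\mathrm{P}^X$-isomorphism mapping it onto some set rankable in $\mathrm{FP}^X$. -}

module Defs where

open import Data.Nat using (ℕ; zero; suc; _+_; _*_; _^_; _≤_)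
open import Data.Nat.DivMod using (_/_; _%_)
open import Data.Bool using (Bool; true; false; _∧_; _∨_; if_then_else_; not)
open import Data.Fin using (Fin) renaming (zero to fz; suc to fs)
import Data.Fin as F
open import Data.List using (List; []; _∷_; length; filter; map; concatMap; reverse; _++_; takeWhile; upTo)
open import Data.Product using (Σ; ∃; _×_; _,_; proj₁; proj₂)
open import Relation.Nullary.Decidable using (does; ⌊_⌋)
open import Relation.Binary.PropositionalEquality using (_≡_)
open import Relation.Unary using (Pred)

Str : Set
Str = List Bool

Lang : Set
Lang = Str → Bool

lexLeq : Str → Str → Bool
lexLeq []          _           = true
lexLeq (_ ∷ _)     []          = false
lexLeq (false ∷ x) (true  ∷ y) = true
lexLeq (true  ∷ x) (false ∷ y) = false
lexLeq (false ∷ x) (false ∷ y) = lexLeq x y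
lexLeq (true  ∷ x) (true  ∷ y) = lexLeq x y

ltNat : ℕ → ℕ → Bool
ltNat m n = ⌊ suc m Data.Nat.≤? n ⌋

eqNat : ℕ → ℕ → Bool
eqNat m n = ⌊ m Data.Nat.≟ n ⌋

_≤ₛ_ : Str → Str → Bool
x ≤ₛ y = ltNat (length x) (length y) ∨ (eqNat (length x) (length y) ∧ lexLeq x y)

strings : ℕ → List Str
strings zero    = [] ∷ []
strings (suc n) = concatMap (λ w → (false ∷ w) ∷ (true ∷ w) ∷ []) (strings n)

stringsUpTo : ℕ → List Str
stringsUpTo n = concatMap strings (upTo (suc n))

count : (Str → Bool) → List Str → ℕ
count p ws = length (filter (λ w → p w Data.Bool.≟ true) ws)

-- census_A(1^n) = |{ x ∈ A : |x| = n }|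
census : Lang → ℕ → ℕ
census A n = count A (strings n)

rank : Lang → Str → ℕ
rank A x = count (λ y → (y ≤ₛ x) ∧ A y) (stringsUpTo (length x))

ones : ℕ → Str
ones zero    = []
ones (suc n) = true ∷ ones n

-- binary representation of a natural number (least significant bit first,
-- no trailing zero bits; 0 is the empty string)
binAux : ℕ → ℕ → Str
binAux zero     n = []
binAux (suc f) zero = []
binAux (suc f) (suc n) = eqNat ((suc n) % 2) 1 ∷ binAux f ((suc n) / 2)

bin : ℕ → Str
bin n = binAux n n

-- Deterministic oracle Turing transducers (two tapes: a work/input/output
-- tape and an oracle query tape), with a step-by-step semantics.

-- tape symbols: 0 = blank, 1 = bit 0, 2 = bit 1
Sym : Set
Sym = Fin 3

blank : Sym
blank = fz

bitSym : Bool → Sym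
bitSym false = fs fz
bitSym true  = fs (fs fz)

data Move : Set where
  left stay right : Move

-- a two-way infinite tape as a zipper
record Tape : Set where
  constructor tape
  field
    lft  : List Sym   -- cells left of the head, nearest first
    cur  : Sym
    rgt  : List Sym   -- cells right of the head, nearest first
open Tape public

emptyTape : Tape
emptyTape = tape [] blank []

moveTape : Move → Tape → Tape
moveTape left  (tape []       c r) = tape [] blank (c ∷ r)
moveTape left  (tape (l ∷ ls) c r) = tape ls l (c ∷ r)
moveTape stay  t                   = t
moveTape right (tape l c [])       = tape (c ∷ l) blank []
moveTape right (tape l c (x ∷ rs)) = tape (c ∷ l) x rs

writeMove : Sym × Move → Tape → Tape
writeMove (s , m) (tape l _ r) = moveTape m (tape l s r)

isBlank : Sym → Bool
isBlank fz = true
isBlank (fs _) = false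

symBit : Sym → Bool
symBit (fs (fs fz)) = true
symBit _            = false

tapeWord : Tape → Str
tapeWord (tape l c r) =
  map symBit (filter (λ s → not (isBlank s) Data.Bool.≟ true) (reverse l ++ c ∷ r))

outWord : Tape → Str
outWord (tape _ c r) = map symBit (takeWhile (λ s → not (isBlank s) Data.Bool.≟ true) (c ∷ r))

record OracleTM : Set where
  field
    Q      : ℕ
    start  : Fin Q
    halt   : Fin Q
    query  : Fin Q
    yes    : Fin Q
    no     : Fin Q
    δ      : Fin Q → Sym → Sym → Fin Q × (Sym × Move) × (Sym × Move)

record Config (M : OracleTM) : Set where
  constructor config
  field
    state : Fin (OracleTM.Q M)
    work  : Tape
    qtape : Tape
open Config public

initConfig : (M : OracleTM) → Str → Config M
initConfig M []      = config (OracleTM.start M) emptyTape emptyTape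
initConfig M (b ∷ x) = config (OracleTM.start M) (tape [] (bitSym b) (map bitSym x)) emptyTape

step : Lang → (M : OracleTM) → Config M → Config M
step X M (config q w t) with does (q F.≟ OracleTM.halt M)
... | true  = config q w t
... | false with does (q F.≟ OracleTM.query M)
...   | true  = config (if X (tapeWord t) then OracleTM.yes M else OracleTM.no M) w emptyTape
...   | false with OracleTM.δ M q (cur w) (cur t)
...     | (q' , a , b) = config q' (writeMove a w) (writeMove b t)

run : Lang → (M : OracleTM) → ℕ → Config M → Config M
run X M zero    c = c
run X M (suc n) c = run X M n (step X M c)

ComputesInTime : Lang → OracleTM → ℕ → (Str → Str) → Set
ComputesInTime X M k f =
  (x : Str) →
    let c = run X M ((length x + 2) ^ k) (initConfig M x) in
    (state c ≡ OracleTM.halt M) × (outWord (work c) ≡ f x)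

FP : Lang → (Str → Str) → Set
FP X f = Σ OracleTM λ M → Σ ℕ λ k → ComputesInTime X M k f

P : Lang → Lang → Set
P X A = FP X (λ x → if A x then true ∷ [] else false ∷ [])

RankableIn : Lang → Lang → Set
RankableIn X A = FP X (λ x → bin (rank A x))

IsPIso : Lang → (Str → Str) → (Str → Str) → Set
IsPIso X φ ψ = FP X φ × FP X ψ × ((x : Str) → ψ (φ x) ≡ x) × ((y : Str) → φ (ψ y) ≡ y)

Scalable : Lang → Lang → Set
Scalable X A =
  Σ (Str → Str) λ φ → Σ (Str → Str) λ ψ → IsPIso X φ ψ ×
  Σ Lang λ B → ((x : Str) → B (φ x) ≡ A x) × RankableIn X B

-- census_A ∈ FP^X : some polynomial-time oracle transducer maps 1^n to the
-- binary representation of census_A(1^n)  (census_A is a function on {1}^*)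
CensusInFP : Lang → Lang → Set
CensusInFP X A =
  Σ OracleTM λ M → Σ ℕ λ k → (n : ℕ) →
    let c = run X M ((n + 2) ^ k) (initConfig M (ones n)) in
    (state c ≡ OracleTM.halt M) × (outWord (work c) ≡ bin (census A n))

{-# OPTIONS --safe #-}

-- D is built in stages at lengths level 0 < level 1 < ⋯, each exponentially beyond the previous one.
-- Stage j decodes j into an oracle machine M and an exponent K and runs M for its time bound, with the
-- part of D built so far as oracle, on 1^(level j) (against the census) or on 1^L with L the largest
-- length φ can produce from inputs of length level j (against the rank of a scaled image B = φ[D]).
-- If M outputs the value that would be right if nothing were added at length level j, the stage adds a
-- string of that length which M did not query; one exists since M makes fewer than 2 ^ level j queries.
-- Nothing M can see changes later, so M is wrong at its input.  For the rank, φ and φ⁻¹ change lengths only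
-- polynomially while D is empty between consecutive levels, so rank_B(1^L) = |D ∩ Σ^{≤ level j}|.
-- Finally every X is in P^X: copy the input to the query tape and ask.

module Submission where

open import Defs
open import Data.Bool as Bool using (Bool; true; false; _∧_; _∨_; if_then_else_; not)
import Data.Bool.Properties as Boolₚ
open import Data.Empty using (⊥-elim)
open import Data.Fin as Fin using (Fin; toℕ; fromℕ<) renaming (zero to fz; suc to fs)
open import Data.Fin.Properties using (toℕ-injective; toℕ<n; fromℕ<-toℕ; toℕ-fromℕ<)
open import Data.List using (List; []; _∷_; length; filter; map; concatMap; reverse; _++_; _ʳ++_; takeWhile; drop; allFin; cartesianProduct)
open import Data.List.Properties using (≡-dec; length-map; length-++; length-reverse; length-filter; reverse-involutive)
open import Data.List.Membership.Propositional using (_∈_; _∉_; find; lose)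
open import Data.List.Membership.DecPropositional (≡-dec Bool._≟_) using (_∈?_; _∉?_)
open import Data.List.Membership.Propositional.Properties
  using (∈-∃++; ∈-concatMap⁺; ∈-concatMap⁻; ∈-++⁺ˡ; ∈-++⁺ʳ; ∈-++⁻; ∈-map⁻; ∈-filter⁺; ∈-filter⁻; ∈-upTo⁺; ∈-upTo⁻;
         ∈-allFin; ∈-cartesianProduct⁺)
open import Data.List.Relation.Binary.Subset.Propositional using (_⊆_)
open import Data.List.Relation.Unary.All as All using ([]; _∷_)
open import Data.List.Relation.Unary.Any as Any using (here; there; any?)
open import Data.List.Relation.Unary.Unique.Propositional using (Unique)
import Data.List.Relation.Unary.Unique.Propositional.Properties as Uniqueₚ
open import Data.List.Relation.Unary.AllPairs using ([]; _∷_)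
open import Data.Maybe using (Maybe; just; nothing)
open import Data.Nat as ℕ using (ℕ; zero; suc; _+_; _*_; _^_; _∸_; _≤_; _<_; z≤n; s≤s; _⊔_; _≟_; _<?_; s≤s⁻¹; ⌊_/2⌋)
open import Data.Nat.Properties
open import Data.Nat.Tactic.RingSolver using (solve-∀)
open import Data.Nat.DivMod using (_/_; _%_; m≡m%n+[m/n]*n; m%n<n; m/n<m)
open import Data.Product using (Σ; ∃; _×_; _,_; proj₁; proj₂)
open import Data.Sum using (_⊎_; inj₁; inj₂)
open import Function using (_∘_; case_of_)
open import Relation.Nullary using (¬_; Dec; yes; no; does)
open import Relation.Nullary.Decidable using (⌊_⌋; isYes≗does; dec-true; dec-false; decidable-stable)
open import Relation.Binary.PropositionalEquality

-- Lists and counting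

module _ {A : Set} where

  ∈-++-skip : ∀ (us vs : List A) {x y} → y ∈ us ++ x ∷ vs → y ≢ x → y ∈ us ++ vs
  ∈-++-skip []       vs (here y≡x)  y≢x = ⊥-elim (y≢x y≡x)
  ∈-++-skip []       vs (there y∈)  _   = y∈
  ∈-++-skip (u ∷ us) vs (here y≡u)  _   = here y≡u
  ∈-++-skip (u ∷ us) vs (there y∈)  y≢x = there (∈-++-skip us vs y∈ y≢x)

  unique-⊆⇒length≤ : ∀ {xs ys : List A} → Unique xs → xs ⊆ ys → length xs ≤ length ys
  unique-⊆⇒length≤ {[]}     _               _     = z≤n
  unique-⊆⇒length≤ {x ∷ xs} (x∉xs ∷ xs!) xs⊆ys with ∈-∃++ (xs⊆ys (here refl))
  ... | us , vs , refl = begin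
    suc (length xs)              ≤⟨ s≤s (unique-⊆⇒length≤ xs! xs⊆us++vs) ⟩
    suc (length (us ++ vs))      ≡⟨ cong suc (length-++ us) ⟩
    suc (length us + length vs)  ≡⟨ +-suc (length us) (length vs) ⟨
    length us + length (x ∷ vs)  ≡⟨ length-++ us ⟨
    length (us ++ x ∷ vs)        ∎
    where
    open ≤-Reasoning
    xs⊆us++vs : xs ⊆ us ++ vs
    xs⊆us++vs y∈xs = ∈-++-skip us vs (xs⊆ys (there y∈xs)) (λ y≡x → All.lookup x∉xs y∈xs (sym y≡x))

  concatMap-unique : ∀ {B : Set} (f : A → List B) (key : B → A) →
                     (∀ x {y} → y ∈ f x → key y ≡ x) → (∀ x → Unique (f x)) →
                     ∀ {xs} → Unique xs → Unique (concatMap f xs)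
  concatMap-unique f key key-f f! {[]}     []           = []
  concatMap-unique f key key-f f! {x ∷ xs} (x∉xs ∷ xs!) =
    Uniqueₚ.++⁺ (f! x) (concatMap-unique f key key-f f! xs!) disjoint
    where
    disjoint : ∀ {v} → ¬ (v ∈ f x × v ∈ concatMap f xs)
    disjoint (v∈fx , v∈rest) with find (∈-concatMap⁻ f v∈rest)
    ... | x′ , x′∈xs , v∈fx′ = All.lookup x∉xs x′∈xs (trans (sym (key-f x v∈fx)) (key-f x′ v∈fx′))

count-cong : ∀ {p q : Lang} xs → (∀ {x} → x ∈ xs → p x ≡ q x) → count p xs ≡ count q xs
count-cong [] _ = refl
count-cong {p} {q} (x ∷ xs) p≗q with p x | q x | p≗q (here refl)
... | true  | .true  | refl = cong suc (count-cong xs (p≗q ∘ there))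
... | false | .false | refl = count-cong xs (p≗q ∘ there)

count-zero : ∀ {p : Lang} xs → (∀ {x} → x ∈ xs → p x ≡ false) → count p xs ≡ 0
count-zero [] _ = refl
count-zero {p} (x ∷ xs) p≗false with p x | p≗false (here refl)
... | .false | refl = count-zero xs (p≗false ∘ there)

count-∨ : ∀ {p q : Lang} xs → (∀ {x} → x ∈ xs → p x ≡ true → q x ≡ false) →
          count (λ x → p x ∨ q x) xs ≡ count p xs + count q xs
count-∨ [] _ = refl
count-∨ {p} {q} (x ∷ xs) disjoint with p x | q x | disjoint (here refl)
... | true  | true  | d = case d refl of λ ()
... | true  | false | _ = cong suc (count-∨ xs (disjoint ∘ there))
... | false | true  | _ = trans (cong suc (count-∨ xs (disjoint ∘ there))) (sym (+-suc (count p xs) (count q xs)))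
... | false | false | _ = count-∨ xs (disjoint ∘ there)

count-≤-injection : ∀ {p q : Lang} (f : Str → Str) {xs ys} → Unique xs → (∀ {x y} → f x ≡ f y → x ≡ y) →
                    (∀ {x} → x ∈ xs → p x ≡ true → f x ∈ ys × q (f x) ≡ true) → count p xs ≤ count q ys
count-≤-injection {p} {q} f {xs} {ys} xs! f-inj f-maps = begin
  count p xs               ≡⟨ length-map f selected ⟨
  length (map f selected)  ≤⟨ unique-⊆⇒length≤ (Uniqueₚ.map⁺ f-inj (Uniqueₚ.filter⁺ p? xs!)) image⊆ ⟩
  count q ys               ∎
  where
  open ≤-Reasoning
  p? = λ w → p w Bool.≟ true
  q? = λ w → q w Bool.≟ true
  selected = filter p? xs
  image⊆ : map f selected ⊆ filter q? ys
  image⊆ y∈ with ∈-map⁻ f y∈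
  ... | x , x∈ , refl with ∈-filter⁻ p? x∈
  ... | x∈xs , px with f-maps x∈xs px
  ... | fx∈ys , qfx = ∈-filter⁺ q? fx∈ys qfx

_≟ₛ_ : (x y : Str) → Dec (x ≡ y)
_≟ₛ_ = ≡-dec Bool._≟_

does-true : ∀ {A : Set} (a? : Dec A) → does a? ≡ true → A
does-true (yes a) _ = a

count-≟ₛ : ∀ z {xs} → Unique xs → z ∈ xs → count (λ x → does (x ≟ₛ z)) xs ≡ 1
count-≟ₛ z (z∉xs ∷ _) (here refl) rewrite dec-true (z ≟ₛ z) refl =
  cong suc (count-zero _ (λ x∈xs → dec-false (_ ≟ₛ z) (λ x≡z → All.lookup z∉xs x∈xs (sym x≡z))))
count-≟ₛ z {x ∷ _} (x∉xs ∷ xs!) (there z∈xs) rewrite dec-false (x ≟ₛ z) (All.lookup x∉xs z∈xs) =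
  count-≟ₛ z xs! z∈xs

-- Strings

extend : Str → List Str
extend w = (false ∷ w) ∷ (true ∷ w) ∷ []

∈-strings⇒length : ∀ n {w} → w ∈ strings n → length w ≡ n
∈-strings⇒length zero    (here refl) = refl
∈-strings⇒length (suc n) w∈ with find (∈-concatMap⁻ extend {xs = strings n} w∈)
... | v , v∈ , here refl         = cong suc (∈-strings⇒length n v∈)
... | v , v∈ , there (here refl) = cong suc (∈-strings⇒length n v∈)

∈-strings : ∀ w → w ∈ strings (length w)
∈-strings []          = here refl
∈-strings (false ∷ w) = ∈-concatMap⁺ extend {xs = strings (length w)} (lose (∈-strings w) (here refl))
∈-strings (true ∷ w)  = ∈-concatMap⁺ extend {xs = strings (length w)} (lose (∈-strings w) (there (here refl)))

strings-unique : ∀ n → Unique (strings n)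
strings-unique zero    = [] ∷ []
strings-unique (suc n) = concatMap-unique extend (drop 1) drop-extend extend-unique (strings-unique n)
  where
  drop-extend : ∀ w {v} → v ∈ extend w → drop 1 v ≡ w
  drop-extend w (here refl)         = refl
  drop-extend w (there (here refl)) = refl
  extend-unique : ∀ w → Unique (extend w)
  extend-unique w = ((λ ()) ∷ []) ∷ [] ∷ []

length-strings : ∀ n → length (strings n) ≡ 2 ^ n
length-strings zero    = refl
length-strings (suc n) = trans (length-concatMap-extend (strings n)) (cong (2 *_) (length-strings n))
  where
  length-concatMap-extend : ∀ ws → length (concatMap extend ws) ≡ 2 * length ws
  length-concatMap-extend []       = refl
  length-concatMap-extend (w ∷ ws) =
    trans (cong (suc ∘ suc) (length-concatMap-extend ws)) (sym (*-suc 2 (length ws)))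

∈-stringsUpTo⇒length≤ : ∀ n {w} → w ∈ stringsUpTo n → length w ≤ n
∈-stringsUpTo⇒length≤ n w∈ with find (∈-concatMap⁻ strings w∈)
... | m , m∈ , w∈strings-m with ∈-upTo⁻ m∈
... | s≤s m≤n = subst (_≤ n) (sym (∈-strings⇒length m w∈strings-m)) m≤n

∈-stringsUpTo : ∀ n {w} → length w ≤ n → w ∈ stringsUpTo n
∈-stringsUpTo n {w} |w|≤n = ∈-concatMap⁺ strings (lose (∈-upTo⁺ (s≤s |w|≤n)) (∈-strings w))

stringsUpTo-unique : ∀ n → Unique (stringsUpTo n)
stringsUpTo-unique n =
  concatMap-unique strings length ∈-strings⇒length strings-unique (Uniqueₚ.upTo⁺ (suc n))

length-ones : ∀ n → length (ones n) ≡ n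
length-ones zero    = refl
length-ones (suc n) = cong suc (length-ones n)

lexLeq-ones : ∀ w → lexLeq w (ones (length w)) ≡ true
lexLeq-ones []          = refl
lexLeq-ones (false ∷ w) = refl
lexLeq-ones (true ∷ w)  = lexLeq-ones w

⌊⌋-true : ∀ {A : Set} (a? : Dec A) → A → ⌊ a? ⌋ ≡ true
⌊⌋-true a? a = trans (isYes≗does a?) (dec-true a? a)

≤ₛ-ones : ∀ {L} w → length w ≤ L → (w ≤ₛ ones L) ≡ true
≤ₛ-ones {L} w |w|≤L =
  subst (λ n → ltNat (length w) n ∨ (eqNat (length w) n ∧ lexLeq w (ones L)) ≡ true)
        (sym (length-ones L)) (by-length (m≤n⇒m<n∨m≡n |w|≤L))
  where
  by-length : ∀ {n} → length w < n ⊎ length w ≡ n →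
              ltNat (length w) n ∨ (eqNat (length w) n ∧ lexLeq w (ones n)) ≡ true
  by-length {n} (inj₁ |w|<n) = cong (_∨ (eqNat (length w) n ∧ lexLeq w (ones n))) (⌊⌋-true (suc (length w) ℕ.≤? n) |w|<n)
  by-length     (inj₂ refl)  =
    trans (cong₂ (λ a b → ltNat (length w) (length w) ∨ (a ∧ b)) (⌊⌋-true (length w ≟ length w) refl) (lexLeq-ones w))
          (Boolₚ.∨-zeroʳ _)

rank-ones : ∀ B L → rank B (ones L) ≡ count B (stringsUpTo L)
rank-ones B L =
  trans (cong (count below-1ᴸ ∘ stringsUpTo) (length-ones L))
        (count-cong {below-1ᴸ} {B} (stringsUpTo L) (λ {y} y∈ → cong (_∧ B y) (≤ₛ-ones y (∈-stringsUpTo⇒length≤ L y∈))))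
  where
  below-1ᴸ : Lang
  below-1ᴸ y = (y ≤ₛ ones L) ∧ B y

unbin : Str → ℕ
unbin []      = 0
unbin (b ∷ s) = (if b then 1 else 0) + 2 * unbin s

unbin-bin : ∀ n → unbin (bin n) ≡ n
unbin-bin n = unbin-binAux n n ≤-refl
  where
  bit-value : ∀ r → r < 2 → (if eqNat r 1 then 1 else 0) ≡ r
  bit-value zero          _ = refl
  bit-value (suc zero)    _ = refl
  bit-value (suc (suc r)) (s≤s (s≤s ()))
  unbin-binAux : ∀ fuel n → n ≤ fuel → unbin (binAux fuel n) ≡ n
  unbin-binAux zero       zero    _         = refl
  unbin-binAux (suc fuel) zero    _         = refl
  unbin-binAux (suc fuel) (suc n) (s≤s n≤fuel) = begin
    (if eqNat (suc n % 2) 1 then 1 else 0) + 2 * unbin (binAux fuel (suc n / 2))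
      ≡⟨ cong₂ _+_ (bit-value (suc n % 2) (m%n<n (suc n) 2))
                   (cong (2 *_) (unbin-binAux fuel (suc n / 2) half≤fuel)) ⟩
    suc n % 2 + 2 * (suc n / 2)  ≡⟨ cong (suc n % 2 +_) (*-comm 2 (suc n / 2)) ⟩
    suc n % 2 + suc n / 2 * 2    ≡⟨ m≡m%n+[m/n]*n (suc n) 2 ⟨
    suc n                        ∎
    where
    open ≡-Reasoning
    half≤fuel : suc n / 2 ≤ fuel
    half≤fuel = ≤-trans (s≤s⁻¹ (m/n<m (suc n) 2 (s≤s (s≤s z≤n)))) n≤fuel

-- Oracle machines

module _ (M : OracleTM) where
  open OracleTM M using (halt; query)

  pendingQuery : Config M → List Str
  pendingQuery (config q _ qt) with q Fin.≟ halt
  ... | yes _ = []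
  ... | no _ with q Fin.≟ query
  ...   | yes _ = tapeWord qt ∷ []
  ...   | no _  = []

  queries : Lang → ℕ → Config M → List Str
  queries X zero    c = []
  queries X (suc t) c = pendingQuery c ++ queries X t (step X M c)

  step-agree : ∀ X Y c → (∀ {s} → s ∈ pendingQuery c → X s ≡ Y s) → step X M c ≡ step Y M c
  step-agree X Y (config q w qt) X≗Y with q Fin.≟ halt
  ... | yes _ = refl
  ... | no _ with q Fin.≟ query
  ...   | yes _ = cong (λ b → config (if b then OracleTM.yes M else OracleTM.no M) w emptyTape) (X≗Y (here refl))
  ...   | no _  = refl

  run-agree : ∀ X Y t c → (∀ {s} → s ∈ queries X t c → X s ≡ Y s) → run X M t c ≡ run Y M t c
  run-agree X Y zero    c _   = refl
  run-agree X Y (suc t) c X≗Y = begin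
    run X M t (step X M c)  ≡⟨ run-agree X Y t (step X M c) (X≗Y ∘ ∈-++⁺ʳ (pendingQuery c)) ⟩
    run Y M t (step X M c)  ≡⟨ cong (run Y M t) (step-agree X Y c (X≗Y ∘ ∈-++⁺ˡ)) ⟩
    run Y M t (step Y M c)  ∎
    where open ≡-Reasoning

  length-pendingQuery : ∀ c → length (pendingQuery c) ≤ 1
  length-pendingQuery (config q _ _) with q Fin.≟ halt
  ... | yes _ = z≤n
  ... | no _ with q Fin.≟ query
  ...   | yes _ = ≤-refl
  ...   | no _  = z≤n

  length-queries : ∀ X t c → length (queries X t c) ≤ t
  length-queries X zero    c = z≤n
  length-queries X (suc t) c = ≤-trans (≤-reflexive (length-++ (pendingQuery c)))
                                       (+-mono-≤ (length-pendingQuery c) (length-queries X t (step X M c)))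

tsize : Tape → ℕ
tsize (tape l _ r) = suc (length l + length r)

moveTape-size : ∀ m t → tsize (moveTape m t) ≤ suc (tsize t)
moveTape-size left  (tape []      c r)       = ≤-refl
moveTape-size left  (tape (x ∷ l) c r)       = s≤s (≤-trans (≤-reflexive (+-suc (length l) (length r))) (n≤1+n _))
moveTape-size stay  t                        = n≤1+n _
moveTape-size right (tape l c [])            = ≤-refl
moveTape-size right (tape l c (x ∷ r))       = s≤s (≤-trans (≤-reflexive (sym (+-suc (length l) (length r)))) (n≤1+n _))

writeMove-size : ∀ a t → tsize (writeMove a t) ≤ suc (tsize t)
writeMove-size (s , m) (tape l _ r) = moveTape-size m (tape l s r)

length-tapeWord : ∀ t → length (tapeWord t) ≤ tsize t
length-tapeWord (tape l c r) = begin
  length (map symBit (filter nonBlank? cells)) ≡⟨ length-map symBit (filter nonBlank? cells) ⟩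
  length (filter nonBlank? cells)              ≤⟨ length-filter nonBlank? cells ⟩
  length (reverse l ++ c ∷ r)                  ≡⟨ length-++ (reverse l) ⟩
  length (reverse l) + suc (length r)          ≡⟨ cong (_+ suc (length r)) (length-reverse l) ⟩
  length l + suc (length r)                    ≡⟨ +-suc (length l) (length r) ⟩
  tsize (tape l c r)                           ∎
  where
  open ≤-Reasoning
  nonBlank? = λ s → not (isBlank s) Bool.≟ true
  cells = reverse l ++ c ∷ r

length-outWord : ∀ t → length (outWord t) ≤ tsize t
length-outWord (tape l c r) =
  ≤-trans (≤-reflexive (length-map symBit (takeWhile nonBlank? (c ∷ r))))
          (≤-trans (length-takeWhile (c ∷ r)) (s≤s (m≤n+m (length r) (length l))))
  where
  nonBlank? = λ s → not (isBlank s) Bool.≟ true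
  length-takeWhile : ∀ ss → length (takeWhile nonBlank? ss) ≤ length ss
  length-takeWhile []       = z≤n
  length-takeWhile (s ∷ ss) with not (isBlank s)
  ... | true  = s≤s (length-takeWhile ss)
  ... | false = z≤n

module _ (X : Lang) (M : OracleTM) where
  open OracleTM M using (halt; query)

  run-growth : (f : Config M → ℕ) → (∀ c → f (step X M c) ≤ suc (f c)) →
               ∀ t c → f (run X M t c) ≤ f c + t
  run-growth f f-step zero    c = ≤-reflexive (sym (+-identityʳ (f c)))
  run-growth f f-step (suc t) c = begin
    f (run X M t (step X M c))  ≤⟨ run-growth f f-step t (step X M c) ⟩
    f (step X M c) + t          ≤⟨ +-monoˡ-≤ t (f-step c) ⟩
    suc (f c) + t               ≡⟨ +-suc (f c) t ⟨
    f c + suc t                 ∎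
    where open ≤-Reasoning

  step-work-size : ∀ c → tsize (work (step X M c)) ≤ suc (tsize (work c))
  step-work-size (config q w qt) with q Fin.≟ halt
  ... | yes _ = n≤1+n _
  ... | no _ with q Fin.≟ query
  ...   | yes _ = n≤1+n _
  ...   | no _  = writeMove-size (proj₁ (proj₂ (OracleTM.δ M q (cur w) (cur qt)))) w

  step-qtape-size : ∀ c → tsize (qtape (step X M c)) ≤ suc (tsize (qtape c))
  step-qtape-size (config q w qt) with q Fin.≟ halt
  ... | yes _ = n≤1+n _
  ... | no _ with q Fin.≟ query
  ...   | yes _ = s≤s z≤n
  ...   | no _  = writeMove-size (proj₂ (proj₂ (OracleTM.δ M q (cur w) (cur qt)))) qt

  ∈-pendingQuery⇒length≤ : ∀ c {s} → s ∈ pendingQuery M c → length s ≤ tsize (qtape c)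
  ∈-pendingQuery⇒length≤ (config q w qt) s∈ with q Fin.≟ halt
  ... | no _ with q Fin.≟ query
  ∈-pendingQuery⇒length≤ (config q w qt) (here refl) | no _ | yes _ = length-tapeWord qt

  ∈-queries⇒length≤ : ∀ t c {s} → s ∈ queries M X t c → length s ≤ tsize (qtape c) + t
  ∈-queries⇒length≤ (suc t) c s∈ with ∈-++⁻ (pendingQuery M c) s∈
  ... | inj₁ s∈pending = ≤-trans (∈-pendingQuery⇒length≤ c s∈pending) (m≤m+n _ _)
  ... | inj₂ s∈rest    = begin
    _                               ≤⟨ ∈-queries⇒length≤ t (step X M c) s∈rest ⟩
    tsize (qtape (step X M c)) + t  ≤⟨ +-monoˡ-≤ t (step-qtape-size c) ⟩
    suc (tsize (qtape c)) + t       ≡⟨ +-suc (tsize (qtape c)) t ⟨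
    tsize (qtape c) + suc t         ∎
    where open ≤-Reasoning

  run-+ : ∀ a b c → run X M (a + b) c ≡ run X M b (run X M a c)
  run-+ zero    b c = refl
  run-+ (suc a) b c = run-+ a b (step X M c)

  run-halted : ∀ t c → state c ≡ halt → run X M t c ≡ c
  run-halted zero    c                  _      = refl
  run-halted (suc t) c@(config q w qt) q≡halt with q Fin.≟ halt
  ... | yes _     = run-halted t c q≡halt
  ... | no q≢halt = ⊥-elim (q≢halt q≡halt)

  run-mono : ∀ {a b} c → a ≤ b → state (run X M a c) ≡ halt → run X M b c ≡ run X M a c
  run-mono {a} c a≤b halted with m≤n⇒∃[o]m+o≡n a≤b
  ... | d , refl = trans (run-+ a d c) (run-halted d _ halted)

initConfig-work-size : ∀ M x → tsize (work (initConfig M x)) ≤ suc (length x)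
initConfig-work-size M []      = s≤s z≤n
initConfig-work-size M (b ∷ x) = s≤s (≤-trans (≤-reflexive (length-map bitSym x)) (n≤1+n _))

initConfig-qtape : ∀ M x → qtape (initConfig M x) ≡ emptyTape
initConfig-qtape M []      = refl
initConfig-qtape M (b ∷ x) = refl

Outputs : Lang → (M : OracleTM) → ℕ → Str → Str → Set
Outputs X M t x y = let c = run X M t (initConfig M x) in (state c ≡ OracleTM.halt M) × (outWord (work c) ≡ y)

Outputs-mono : ∀ {X M t t′ x y} → t ≤ t′ → Outputs X M t x y → Outputs X M t′ x y
Outputs-mono {X} {M} {x = x} t≤t′ (halted , out) rewrite run-mono X M (initConfig M x) t≤t′ halted = halted , out

Outputs-length : ∀ {X M t x y} → Outputs X M t x y → length y ≤ suc (length x) + t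
Outputs-length {X} {M} {t} {x} (_ , refl) = begin
  length (outWord (work c))          ≤⟨ length-outWord (work c) ⟩
  tsize (work c)                     ≤⟨ run-growth X M (tsize ∘ work) (step-work-size X M) t (initConfig M x) ⟩
  tsize (work (initConfig M x)) + t  ≤⟨ +-monoˡ-≤ t (initConfig-work-size M x) ⟩
  suc (length x) + t                 ∎
  where
  open ≤-Reasoning
  c = run X M t (initConfig M x)

Action : ℕ → Set
Action Q = Fin Q × (Sym × Move) × (Sym × Move)

mapState : ∀ {Q Q′} → (Fin Q → Fin Q′) → Action Q → Action Q′
mapState f (q , a , b) = f q , a , b

record Relabelling (M M′ : OracleTM) : Set where
  field
    f           : Fin (OracleTM.Q M) → Fin (OracleTM.Q M′)
    f-injective : ∀ {p q} → f p ≡ f q → p ≡ q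
    f-start     : f (OracleTM.start M) ≡ OracleTM.start M′
    f-halt      : f (OracleTM.halt M)  ≡ OracleTM.halt M′
    f-query     : f (OracleTM.query M) ≡ OracleTM.query M′
    f-yes       : f (OracleTM.yes M)   ≡ OracleTM.yes M′
    f-no        : f (OracleTM.no M)    ≡ OracleTM.no M′
    f-δ         : ∀ q a b → OracleTM.δ M′ (f q) a b ≡ mapState f (OracleTM.δ M q a b)

module _ {M M′ : OracleTM} (ρ : Relabelling M M′) where
  open Relabelling ρ

  relabel : Config M → Config M′
  relabel (config q w qt) = config (f q) w qt

  step-relabel : ∀ X c → step X M′ (relabel c) ≡ relabel (step X M c)
  step-relabel X (config q w qt) with q Fin.≟ OracleTM.halt M | f q Fin.≟ OracleTM.halt M′
  ... | yes _   | yes _    = refl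
  ... | yes q≡h | no fq≢h  = ⊥-elim (fq≢h (trans (cong f q≡h) f-halt))
  ... | no q≢h  | yes fq≡h = ⊥-elim (q≢h (f-injective (trans fq≡h (sym f-halt))))
  ... | no _    | no _ with q Fin.≟ OracleTM.query M | f q Fin.≟ OracleTM.query M′
  ...   | yes _   | yes _    = cong (λ q′ → config q′ w emptyTape) (answer (X (tapeWord qt)))
    where
    answer : ∀ b → (if b then OracleTM.yes M′ else OracleTM.no M′) ≡ f (if b then OracleTM.yes M else OracleTM.no M)
    answer true  = sym f-yes
    answer false = sym f-no
  ...   | yes q≡q | no fq≢q  = ⊥-elim (fq≢q (trans (cong f q≡q) f-query))
  ...   | no q≢q  | yes fq≡q = ⊥-elim (q≢q (f-injective (trans fq≡q (sym f-query))))
  ...   | no _    | no _     =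
    cong (λ e → config (proj₁ e) (writeMove (proj₁ (proj₂ e)) w) (writeMove (proj₂ (proj₂ e)) qt)) (f-δ q (cur w) (cur qt))

  run-relabel : ∀ X t c → run X M′ t (relabel c) ≡ relabel (run X M t c)
  run-relabel X zero    c = refl
  run-relabel X (suc t) c = trans (cong (run X M′ t) (step-relabel X c)) (run-relabel X t (step X M c))

  initConfig-relabel : ∀ x → relabel (initConfig M x) ≡ initConfig M′ x
  initConfig-relabel []      = cong (λ q → config q emptyTape emptyTape) f-start
  initConfig-relabel (b ∷ x) = cong (λ q → config q (tape [] (bitSym b) (map bitSym x)) emptyTape) f-start

  Outputs-relabel : ∀ {X t x y} → Outputs X M t x y → Outputs X M′ t x y
  Outputs-relabel {X} {t} {x} (halted , out)
    rewrite sym (initConfig-relabel x) | run-relabel X t (initConfig M x) =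
    trans (cong f halted) f-halt , out

-- Every set is in P relative to itself

pattern copying  = fz
pattern asking   = fs fz
pattern accepted = fs (fs fz)
pattern rejected = fs (fs (fs fz))
pattern done     = fs (fs (fs (fs fz)))

queryInputδ : Fin 5 → Sym → Sym → Action 5
queryInputδ copying  fz     _ = asking  , (blank , stay)         , (blank , stay)
queryInputδ copying  (fs s) _ = copying , (blank , right)        , (fs s , right)
queryInputδ accepted _      _ = done    , (bitSym true , stay)   , (blank , stay)
queryInputδ rejected _      _ = done    , (bitSym false , stay)  , (blank , stay)
queryInputδ _        _      _ = done    , (blank , stay)         , (blank , stay)

queryInput : OracleTM
queryInput = record { Q = 5 ; start = copying ; halt = done ; query = asking
                    ; yes = accepted ; no = rejected ; δ = queryInputδ }

inputTape : List Sym → Str → Tape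
inputTape L []      = tape L blank []
inputTape L (b ∷ x) = tape L (bitSym b) (map bitSym x)

erased : Str → List Sym → List Sym
erased []      L = L
erased (b ∷ x) L = erased x (blank ∷ L)

tapeWord-copied : ∀ x → tapeWord (tape (map bitSym x ʳ++ []) blank []) ≡ x
tapeWord-copied x rewrite reverse-involutive (map bitSym x) = bits x
  where
  bits : ∀ x → map symBit (filter (λ s → not (isBlank s) Bool.≟ true) (map bitSym x ++ blank ∷ [])) ≡ x
  bits []          = refl
  bits (false ∷ x) = cong (false ∷_) (bits x)
  bits (true ∷ x)  = cong (true ∷_) (bits x)

module _ (X : Lang) where

  copy-input : ∀ x L Qs d →
    run X queryInput (length x + d) (config copying (inputTape L x) (tape Qs blank [])) ≡
    run X queryInput d (config copying (tape (erased x L) blank []) (tape (map bitSym x ʳ++ Qs) blank []))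
  copy-input []              L Qs d = refl
  copy-input (false ∷ [])     L Qs d = refl
  copy-input (true ∷ [])      L Qs d = refl
  copy-input (false ∷ b ∷ x)  L Qs d = copy-input (b ∷ x) (blank ∷ L) (bitSym false ∷ Qs) d
  copy-input (true ∷ b ∷ x)   L Qs d = copy-input (b ∷ x) (blank ∷ L) (bitSym true ∷ Qs) d

  ask-copied : ∀ x L → run X queryInput 3 (config copying (tape L blank []) (tape (map bitSym x ʳ++ []) blank [])) ≡
                       config done (tape L (bitSym (X x)) []) emptyTape
  ask-copied x L rewrite tapeWord-copied x with X x
  ... | true  = refl
  ... | false = refl

  queryInput-outputs : ∀ x → Outputs X queryInput (length x + 3) x (if X x then true ∷ [] else false ∷ [])
  queryInput-outputs x = cong state final , trans (cong (outWord ∘ work) final) (outWord-bit (X x))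
    where
    final : run X queryInput (length x + 3) (initConfig queryInput x) ≡ config done (tape (erased x []) (bitSym (X x)) []) emptyTape
    final = trans (cong (run X queryInput (length x + 3)) (initConfig-inputTape x))
                  (trans (copy-input x [] [] 3) (ask-copied x (erased x [])))
      where
      initConfig-inputTape : ∀ x → initConfig queryInput x ≡ config copying (inputTape [] x) emptyTape
      initConfig-inputTape []      = refl
      initConfig-inputTape (b ∷ x) = refl
    outWord-bit : ∀ b → outWord (tape (erased x []) (bitSym b) []) ≡ (if b then true ∷ [] else false ∷ [])
    outWord-bit true  = refl
    outWord-bit false = refl

n+3≤[n+2]² : ∀ n → n + 3 ≤ (n + 2) ^ 2
n+3≤[n+2]² n = subst (n + 3 ≤_) (sym (expand n)) (m≤m+n (n + 3) (n * n + 3 * n + 1))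
  where
  -- the left side is (m + 2) ^ 2 unfolded
  expand : ∀ m → (m + 2) * ((m + 2) * 1) ≡ m + 3 + (m * m + 3 * m + 1)
  expand = solve-∀

P-self : ∀ X → P X X
P-self X = queryInput , 2 , λ x → Outputs-mono (n+3≤[n+2]² (length x)) (queryInput-outputs X x)

-- Coding machines by numbers

double : ℕ → ℕ
double zero    = zero
double (suc m) = suc (suc (double m))

odd : ℕ → Bool
odd zero          = false
odd (suc zero)    = true
odd (suc (suc n)) = odd n

double^ : ℕ → ℕ → ℕ
double^ zero    m = m
double^ (suc a) m = double (double^ a m)

-- a₀ ∷ a₁ ∷ … ∷ aₖ is coded by the number whose binary expansion, least significant bit first, is 0^a₀ 1 0^a₁ 1 … 0^aₖ 1.
encodeList : List ℕ → ℕ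
encodeList []      = 0
encodeList (a ∷ l) = double^ a (suc (double (encodeList l)))

decodeList-go : (fuel zeros : ℕ) → ℕ → List ℕ
decodeList-go zero       zeros n       = []
decodeList-go (suc fuel) zeros zero    = []
decodeList-go (suc fuel) zeros (suc n) =
  if odd (suc n) then zeros ∷ decodeList-go fuel 0 ⌊ suc n /2⌋ else decodeList-go fuel (suc zeros) ⌊ suc n /2⌋

decodeList : ℕ → List ℕ
decodeList n = decodeList-go n 0 n

⌊double/2⌋ : ∀ m → ⌊ double m /2⌋ ≡ m
⌊double/2⌋ zero    = refl
⌊double/2⌋ (suc m) = cong suc (⌊double/2⌋ m)

⌊suc-double/2⌋ : ∀ m → ⌊ suc (double m) /2⌋ ≡ m
⌊suc-double/2⌋ zero    = refl
⌊suc-double/2⌋ (suc m) = cong suc (⌊suc-double/2⌋ m)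

odd-double : ∀ m → odd (double m) ≡ false
odd-double zero    = refl
odd-double (suc m) = odd-double m

odd-suc-double : ∀ m → odd (suc (double m)) ≡ true
odd-suc-double zero    = refl
odd-suc-double (suc m) = odd-suc-double m

m≤double : ∀ m → m ≤ double m
m≤double zero    = z≤n
m≤double (suc m) = s≤s (m≤n⇒m≤1+n (m≤double m))

double^-suc : ∀ a m → ∃ λ p → double^ a (suc m) ≡ suc p
double^-suc zero    m = m , refl
double^-suc (suc a) m with double^-suc a m
... | p , eq = suc (double p) , cong double eq

decodeList-go-fuel : ∀ {fuel fuel′} zeros n → n ≤ fuel → n ≤ fuel′ →
                     decodeList-go fuel zeros n ≡ decodeList-go fuel′ zeros n
decodeList-go-fuel {zero}     {zero}      zeros n       _ _ = refl
decodeList-go-fuel {zero}     {suc _}     zeros zero    _ _ = refl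
decodeList-go-fuel {suc _}    {zero}      zeros zero    _ _ = refl
decodeList-go-fuel {suc _}    {suc _}     zeros zero    _ _ = refl
decodeList-go-fuel {suc fuel} {suc fuel′} zeros (suc n) (s≤s n≤fuel) (s≤s n≤fuel′) =
  cong₂ (λ a b → if odd (suc n) then zeros ∷ a else b) (decodeList-go-fuel 0 ⌊ suc n /2⌋ half≤fuel half≤fuel′)
                                                       (decodeList-go-fuel (suc zeros) ⌊ suc n /2⌋ half≤fuel half≤fuel′)
  where
  half≤fuel  = ≤-trans (s≤s⁻¹ (⌊n/2⌋<n n)) n≤fuel
  half≤fuel′ = ≤-trans (s≤s⁻¹ (⌊n/2⌋<n n)) n≤fuel′

decodeList-go-double^ : ∀ a m {fuel} zeros → double^ a (suc (double m)) ≤ fuel →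
                        decodeList-go fuel zeros (double^ a (suc (double m))) ≡ (a + zeros) ∷ decodeList m
decodeList-go-double^ zero m {suc fuel} zeros (s≤s ≤fuel) rewrite odd-suc-double m | ⌊suc-double/2⌋ m =
  cong (zeros ∷_) (decodeList-go-fuel 0 m (≤-trans (m≤double m) ≤fuel) ≤-refl)
decodeList-go-double^ (suc a) m {fuel} zeros ≤fuel with double^-suc a (double m)
... | p , eq with fuel | subst (λ k → double k ≤ fuel) eq ≤fuel
...   | suc fuel′ | s≤s ≤fuel′ rewrite eq | odd-double p | ⌊double/2⌋ p =
  trans (cong (decodeList-go fuel′ (suc zeros)) (sym eq))
        (trans (decodeList-go-double^ a m (suc zeros) (subst (_≤ fuel′) (sym eq) (≤-trans (s≤s (m≤double p)) ≤fuel′)))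
               (cong (_∷ decodeList m) (+-suc a zeros)))

decodeList-encodeList : ∀ l → decodeList (encodeList l) ≡ l
decodeList-encodeList []      = refl
decodeList-encodeList (a ∷ l) =
  trans (decodeList-go-double^ a (encodeList l) 0 ≤-refl) (cong₂ _∷_ (+-identityʳ a) (decodeList-encodeList l))

data Task : Set where
  censusTask rankTask : Task

encodeTask : Task → ℕ
encodeTask censusTask = 1
encodeTask rankTask   = 0

decodeTask : ℕ → Task
decodeTask 1 = censusTask
decodeTask _ = rankTask

decodeTask-encodeTask : ∀ g → decodeTask (encodeTask g) ≡ g
decodeTask-encodeTask censusTask = refl
decodeTask-encodeTask rankTask   = refl

decodeFin : (q : ℕ) → ℕ → Fin (suc q)
decodeFin q n with n <? suc q
... | yes n<q = fromℕ< n<q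
... | no _    = fz

toℕ-decodeFin : ∀ q n → n < suc q → toℕ (decodeFin q n) ≡ n
toℕ-decodeFin q n n<q with n <? suc q
... | yes n<q′ = toℕ-fromℕ< n<q′
... | no n≮q   = ⊥-elim (n≮q n<q)

decodeFin-toℕ : ∀ q (i : Fin (suc q)) → decodeFin q (toℕ i) ≡ i
decodeFin-toℕ q i with toℕ i <? suc q
... | yes i<q = fromℕ<-toℕ i i<q
... | no i≮q  = ⊥-elim (i≮q (toℕ<n i))

encodeMove : Move → ℕ
encodeMove left  = 0
encodeMove stay  = 1
encodeMove right = 2

decodeMove : ℕ → Move
decodeMove 0 = left
decodeMove 1 = stay
decodeMove _ = right

decodeMove-encodeMove : ∀ m → decodeMove (encodeMove m) ≡ m
decodeMove-encodeMove left  = refl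
decodeMove-encodeMove stay  = refl
decodeMove-encodeMove right = refl

encodeAction : ∀ {Q} → Action Q → List ℕ
encodeAction (q , (s₁ , m₁) , (s₂ , m₂)) = toℕ q ∷ toℕ s₁ ∷ encodeMove m₁ ∷ toℕ s₂ ∷ encodeMove m₂ ∷ []

decodeAction : (q : ℕ) → List ℕ → Action (suc q)
decodeAction q (q′ ∷ s₁ ∷ m₁ ∷ s₂ ∷ m₂ ∷ _) =
  decodeFin q q′ , (decodeFin 2 s₁ , decodeMove m₁) , (decodeFin 2 s₂ , decodeMove m₂)
decodeAction q _                          = fz , (blank , stay) , (blank , stay)

-- A transition table is a list of rows  q a b q′ s₁ m₁ s₂ m₂ : in state q reading a, b,
-- go to state q′, writing s₁, s₂ and moving m₁, m₂.
lookupAction : ℕ → ℕ → ℕ → List ℕ → List ℕ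
lookupAction q a b (q′ ∷ a′ ∷ b′ ∷ v₁ ∷ v₂ ∷ v₃ ∷ v₄ ∷ v₅ ∷ rows) =
  if does (q′ ≟ q) ∧ does (a′ ≟ a) ∧ does (b′ ≟ b)
  then v₁ ∷ v₂ ∷ v₃ ∷ v₄ ∷ v₅ ∷ []
  else lookupAction q a b rows
lookupAction _ _ _ _ = []

≡ᵇ-true : ∀ {m n} → m ≡ n → (m ℕ.≡ᵇ n) ≡ true
≡ᵇ-true {m} {n} = dec-true (m ≟ n)

≡ᵇ-false : ∀ {m n} → m ≢ n → (m ℕ.≡ᵇ n) ≡ false
≡ᵇ-false {m} {n} = dec-false (m ≟ n)

haltingMachine : OracleTM
haltingMachine = record { Q = 1 ; start = fz ; halt = fz ; query = fz ; yes = fz ; no = fz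
                        ; δ = λ _ _ _ → fz , (blank , stay) , (blank , stay) }

decodeMachine : List ℕ → OracleTM × ℕ × Task
decodeMachine (g ∷ K ∷ q ∷ s ∷ h ∷ qu ∷ y ∷ n ∷ table) =
  record { Q = suc q ; start = decodeFin q s ; halt = decodeFin q h ; query = decodeFin q qu
         ; yes = decodeFin q y ; no = decodeFin q n
         ; δ = λ p a b → decodeAction q (lookupAction (toℕ p) (toℕ a) (toℕ b) table) } ,
  K , decodeTask g
decodeMachine _ = haltingMachine , 0 , rankTask

decode : ℕ → OracleTM × ℕ × Task
decode j = decodeMachine (decodeList j)

machine : ℕ → OracleTM
machine j = proj₁ (decode j)

exponent : ℕ → ℕ
exponent j = proj₁ (proj₂ (decode j))

task : ℕ → Task
task j = proj₂ (proj₂ (decode j))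

module _ (M : OracleTM) where
  open OracleTM M using (Q; start; halt; query; δ)

  Situation : Set
  Situation = Fin Q × Fin 3 × Fin 3

  situations : List Situation
  situations = cartesianProduct (allFin Q) (cartesianProduct (allFin 3) (allFin 3))

  ∈-situations : ∀ σ → σ ∈ situations
  ∈-situations (q , a , b) = ∈-cartesianProduct⁺ (∈-allFin q) (∈-cartesianProduct⁺ (∈-allFin a) (∈-allFin b))

  row : Situation → List ℕ
  row (q , a , b) = toℕ q ∷ toℕ a ∷ toℕ b ∷ encodeAction (δ q a b)

  describe : ℕ → Task → List ℕ
  describe K g = encodeTask g ∷ K ∷ Q ∸ 1 ∷ toℕ start ∷ toℕ halt ∷ toℕ query
                 ∷ toℕ (OracleTM.yes M) ∷ toℕ (OracleTM.no M) ∷ concatMap row situations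

  lookupAction-rows : ∀ σs {q a b} → (q , a , b) ∈ σs →
                      lookupAction (toℕ q) (toℕ a) (toℕ b) (concatMap row σs) ≡ encodeAction (δ q a b)
  lookupAction-rows ((q′ , a′ , b′) ∷ σs) {q} {a} {b} σ∈
    with toℕ q′ ≟ toℕ q | toℕ a′ ≟ toℕ a | toℕ b′ ≟ toℕ b
  ... | yes q′≡q | yes a′≡a | yes b′≡b
    rewrite ≡ᵇ-true q′≡q | ≡ᵇ-true a′≡a | ≡ᵇ-true b′≡b
          | toℕ-injective q′≡q | toℕ-injective a′≡a | toℕ-injective b′≡b = refl
  ... | no q′≢q | _ | _
    rewrite ≡ᵇ-false q′≢q = lookupAction-rows σs (Any.tail (q′≢q ∘ sym ∘ cong (toℕ ∘ proj₁)) σ∈)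
  ... | yes q′≡q | no a′≢a | _
    rewrite ≡ᵇ-true q′≡q | ≡ᵇ-false a′≢a =
    lookupAction-rows σs (Any.tail (a′≢a ∘ sym ∘ cong (toℕ ∘ proj₁ ∘ proj₂)) σ∈)
  ... | yes q′≡q | yes a′≡a | no b′≢b
    rewrite ≡ᵇ-true q′≡q | ≡ᵇ-true a′≡a | ≡ᵇ-false b′≢b =
    lookupAction-rows σs (Any.tail (b′≢b ∘ sym ∘ cong (toℕ ∘ proj₂ ∘ proj₂)) σ∈)

  decoded : ℕ → Task → OracleTM
  decoded K g = proj₁ (decodeMachine (describe K g))

  relabelling-decoded : ∀ K g → Relabelling M (decoded K g)
  relabelling-decoded K g = record
    { f = f ; f-injective = f-injective
    ; f-start = refl ; f-halt = refl ; f-query = refl ; f-yes = refl ; f-no = refl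
    ; f-δ = f-δ }
    where
    f : Fin Q → Fin (suc (Q ∸ 1))
    f i = decodeFin (Q ∸ 1) (toℕ i)
    toℕ-f : ∀ i → toℕ (f i) ≡ toℕ i
    toℕ-f i = toℕ-decodeFin (Q ∸ 1) (toℕ i) (≤-trans (toℕ<n i) (m≤n+m∸n Q 1))
    f-injective : ∀ {p q} → f p ≡ f q → p ≡ q
    f-injective {p} {q} fp≡fq = toℕ-injective (trans (sym (toℕ-f p)) (trans (cong toℕ fp≡fq) (toℕ-f q)))
    decode-encodeAction : ∀ e → decodeAction (Q ∸ 1) (encodeAction e) ≡ mapState f e
    decode-encodeAction (q′ , (s₁ , m₁) , (s₂ , m₂))
      rewrite decodeFin-toℕ 2 s₁ | decodeFin-toℕ 2 s₂ | decodeMove-encodeMove m₁ | decodeMove-encodeMove m₂ = refl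
    f-δ : ∀ q a b → OracleTM.δ (decoded K g) (f q) a b ≡ mapState f (δ q a b)
    f-δ q a b = begin
      decodeAction (Q ∸ 1) (lookupAction (toℕ (f q)) (toℕ a) (toℕ b) (concatMap row situations))
        ≡⟨ cong (λ n → decodeAction (Q ∸ 1) (lookupAction n (toℕ a) (toℕ b) (concatMap row situations))) (toℕ-f q) ⟩
      decodeAction (Q ∸ 1) (lookupAction (toℕ q) (toℕ a) (toℕ b) (concatMap row situations))
        ≡⟨ cong (decodeAction (Q ∸ 1)) (lookupAction-rows situations (∈-situations (q , a , b))) ⟩
      decodeAction (Q ∸ 1) (encodeAction (δ q a b))
        ≡⟨ decode-encodeAction (δ q a b) ⟩
      mapState f (δ q a b) ∎
      where open ≡-Reasoning

enumerate : ∀ M K g → ∃ λ j → Relabelling M (machine j) × exponent j ≡ K × task j ≡ g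
enumerate M K g =
  encodeList (describe M K g) ,
  subst Enumerates (sym (decodeList-encodeList (describe M K g)))
        (relabelling-decoded M K g , refl , decodeTask-encodeTask g)
  where
  Enumerates : List ℕ → Set
  Enumerates l = let M′ , K′ , g′ = decodeMachine l in Relabelling M M′ × K′ ≡ K × g′ ≡ g

-- Growth of the levels

stretch : ℕ → ℕ → ℕ
stretch n K = suc n + (n + 2) ^ K

tower : ℕ → ℕ
tower b = 2 ^ 2 ^ (b + 4)

poly-mono : ∀ {a b k K} → a ≤ b → k ≤ K → (a + 2) ^ k ≤ (b + 2) ^ K
poly-mono {a} {b} {k} {K} a≤b k≤K = begin
  (a + 2) ^ k  ≤⟨ ^-monoˡ-≤ k (+-monoˡ-≤ 2 a≤b) ⟩
  (b + 2) ^ k  ≡⟨ cong (_^ k) (+-comm b 2) ⟩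
  (2 + b) ^ k  ≤⟨ ^-monoʳ-≤ (2 + b) k≤K ⟩
  (2 + b) ^ K  ≡⟨ cong (_^ K) (+-comm 2 b) ⟩
  (b + 2) ^ K  ∎
  where open ≤-Reasoning

stretch-mono : ∀ {m n K} → m ≤ n → stretch m K ≤ stretch n K
stretch-mono {K = K} m≤n = +-mono-≤ (s≤s m≤n) (poly-mono m≤n (≤-refl {K}))

n≤stretch : ∀ n K → n ≤ stretch n K
n≤stretch n K = ≤-trans (n≤1+n n) (m≤m+n (suc n) _)

FP-length : ∀ {X M k f} → ComputesInTime X M k f → ∀ {n K x} → length x ≤ n → k ≤ K → length (f x) ≤ stretch n K
FP-length {X} {M} {k} computes {x = x} x≤n k≤K =
  ≤-trans (Outputs-length {X} {M} {(length x + 2) ^ k} {x} (computes x)) (+-mono-≤ (s≤s x≤n) (poly-mono x≤n k≤K))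

1≤2^ : ∀ i → 1 ≤ 2 ^ i
1≤2^ i = m^n>0 2 i

2≤2^suc : ∀ i → 2 ≤ 2 ^ suc i
2≤2^suc i = *-monoʳ-≤ 2 (1≤2^ i)

n<2^n : ∀ n → n < 2 ^ n
n<2^n zero    = s≤s z≤n
n<2^n (suc n) = +-mono-≤ (1≤2^ n) (≤-trans (n<2^n n) (m≤m+n (2 ^ n) 0))

+-≤2^ : ∀ {x y} i → x ≤ 2 ^ i → y ≤ 2 ^ i → x + y ≤ 2 ^ suc i
+-≤2^ i x≤ y≤ = ≤-trans (+-mono-≤ x≤ y≤) (≤-reflexive (cong (2 ^ i +_) (sym (+-identityʳ (2 ^ i)))))

*-≤2^ : ∀ {x y} i j → x ≤ 2 ^ i → y ≤ 2 ^ j → x * y ≤ 2 ^ (i + j)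
*-≤2^ i j x≤ y≤ = ≤-trans (*-mono-≤ x≤ y≤) (≤-reflexive (sym (^-distribˡ-+-* 2 i j)))

linear≤exponential : ∀ b → 3 * (b + 4) + 3 ≤ 2 ^ (b + 4)
linear≤exponential zero    = n≤1+n 15
linear≤exponential (suc b) = begin
  3 * (suc b + 4) + 3          ≡⟨ shift b ⟩
  (3 * (b + 4) + 3) + 3        ≤⟨ +-mono-≤ ih (≤-trans (m≤n+m 3 (3 * (b + 4))) ih) ⟩
  2 ^ (b + 4) + 2 ^ (b + 4)    ≡⟨ cong (2 ^ (b + 4) +_) (+-identityʳ _) ⟨
  2 ^ (suc b + 4)              ∎
  where
  open ≤-Reasoning
  ih = linear≤exponential b
  shift : ∀ m → 3 * (suc m + 4) + 3 ≡ 3 * (m + 4) + 3 + 3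
  shift = solve-∀

stretch+2≤2^ : ∀ {n} i K → n + 2 ≤ 2 ^ i → stretch n K + 2 ≤ 2 ^ suc (suc (i * suc K))
stretch+2≤2^ {n} i K n+2≤ = begin
  stretch n K + 2                  ≡⟨ regroup n ((n + 2) ^ K) ⟩
  (n + 2) + ((n + 2) ^ K + 1)      ≤⟨ +-≤2^ (suc (i * suc K)) (≤-trans n+2≤ (^-monoʳ-≤ 2 i≤))
                                                              (+-≤2^ (i * suc K) power≤ (1≤2^ (i * suc K))) ⟩
  2 ^ suc (suc (i * suc K))        ∎
  where
  open ≤-Reasoning
  regroup : ∀ m p → suc m + p + 2 ≡ (m + 2) + (p + 1)
  regroup = solve-∀
  i≤ : i ≤ suc (i * suc K)
  i≤ = m≤n⇒m≤1+n (m≤m*n i (suc K))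
  power≤ : (n + 2) ^ K ≤ 2 ^ (i * suc K)
  power≤ = begin
    (n + 2) ^ K   ≤⟨ ^-monoˡ-≤ K n+2≤ ⟩
    (2 ^ i) ^ K   ≡⟨ ^-*-assoc 2 i K ⟩
    2 ^ (i * K)   ≤⟨ ^-monoʳ-≤ 2 (*-monoʳ-≤ i (n≤1+n K)) ⟩
    2 ^ (i * suc K) ∎

n≤tower : ∀ b → b ≤ tower b
n≤tower b = ≤-trans (<⇒≤ (n<2^n b)) (^-monoʳ-≤ 2 (≤-trans (m≤m+n b 4) (<⇒≤ (n<2^n (b + 4)))))

-- With a = 2 ^ c, c = b + 4: the exponent E below is polynomial in a, and E ≤ 2 ^ (3c + 3) ≤ 2 ^ a.
stretch²<2^tower : ∀ {b K} → K ≤ b → stretch (stretch (tower b) K) K < 2 ^ tower b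
stretch²<2^tower {b} {K} K≤b = begin-strict
  stretch (stretch e K) K      <⟨ m<m+n _ (s≤s z≤n) ⟩
  stretch (stretch e K) K + 2  ≤⟨ stretch+2≤2^ {stretch e K} i₂ K (stretch+2≤2^ {e} (suc a) K e+2≤) ⟩
  2 ^ E                        ≤⟨ ^-monoʳ-≤ 2 E≤e ⟩
  2 ^ e                        ∎
  where
  open ≤-Reasoning
  c  = b + 4
  a  = 2 ^ c
  e  = tower b
  i₂ = suc (suc (suc a * suc K))
  E  = suc (suc (i₂ * suc K))
  e+2≤ : e + 2 ≤ 2 ^ suc a
  e+2≤ = +-≤2^ a ≤-refl (^-monoʳ-≤ 2 (1≤2^ c))
  1+K≤ : suc K ≤ 2 ^ c
  1+K≤ = ≤-trans (s≤s K≤b) (≤-trans (≤-trans (≤-reflexive (+-comm 1 b)) (+-monoʳ-≤ b (s≤s z≤n))) (<⇒≤ (n<2^n c)))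
  1+a≤ : suc a ≤ 2 ^ suc c
  1+a≤ = +-≤2^ c (1≤2^ c) ≤-refl
  i₂≤ : i₂ ≤ 2 ^ suc (suc c + c)
  i₂≤ = +-≤2^ {x = 2} (suc c + c) (2≤2^suc (c + c)) (*-≤2^ (suc c) c 1+a≤ 1+K≤)
  E≤ : E ≤ 2 ^ (3 * c + 3)
  E≤ = subst (λ k → E ≤ 2 ^ k) (three-c+3 c)
             (+-≤2^ {x = 2} (suc (suc c + c) + c) (2≤2^suc (suc c + c + c)) (*-≤2^ (suc (suc c + c)) c i₂≤ 1+K≤))
    where
    three-c+3 : ∀ m → suc (suc (suc m + m) + m) ≡ 3 * m + 3
    three-c+3 = solve-∀
  E≤e : E ≤ e
  E≤e = ≤-trans E≤ (^-monoʳ-≤ 2 (linear≤exponential b))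

-- The oracle

-- The summand exponent j makes level j large enough for machine j
-- (stretch²<2^tower); the summand 2 ^ level j puts everything stage j can query or compute below level (suc j).
levelIndex : ℕ → ℕ
level : ℕ → ℕ

level j = tower (levelIndex j)

levelIndex zero    = exponent zero
levelIndex (suc j) = exponent (suc j) + 2 ^ level j

inputLengthFor : Task → ℕ → ℕ → ℕ
inputLengthFor censusTask n K = n
inputLengthFor rankTask   n K = stretch n K

-- The answer that is correct for D if stage j adds nothing at length level j.
baselineFor : Task → ℕ → Lang → ℕ
baselineFor censusTask n O = 0
baselineFor rankTask   n O = count O (stringsUpTo n)

inputLength : ℕ → ℕ
inputLength j = inputLengthFor (task j) (level j) (exponent j)

budget : ℕ → ℕ
budget j = (inputLength j + 2) ^ exponent j

initial : (j : ℕ) → Config (machine j)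
initial j = initConfig (machine j) (ones (inputLength j))

simulation : (j : ℕ) → Lang → Config (machine j)
simulation j O = run O (machine j) (budget j) (initial j)

simQueries : ℕ → Lang → List Str
simQueries j O = queries (machine j) O (budget j) (initial j)

answer : ℕ → Lang → ℕ
answer j O = unbin (outWord (work (simulation j O)))

baseline : ℕ → Lang → ℕ
baseline j O = baselineFor (task j) (level j) O

horizon : ℕ → ℕ
horizon j = stretch (stretch (level j) (exponent j)) (exponent j)

horizon<2^level : ∀ j → horizon j < 2 ^ level j
horizon<2^level j = stretch²<2^tower (exponent≤levelIndex j)
  where
  exponent≤levelIndex : ∀ j → exponent j ≤ levelIndex j
  exponent≤levelIndex zero    = ≤-refl
  exponent≤levelIndex (suc j) = m≤m+n _ _

2^level≤level-suc : ∀ j → 2 ^ level j ≤ level (suc j)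
2^level≤level-suc j = ≤-trans (m≤n+m (2 ^ level j) (exponent (suc j))) (n≤tower _)

horizon<level-suc : ∀ j → horizon j < level (suc j)
horizon<level-suc j = <-≤-trans (horizon<2^level j) (2^level≤level-suc j)

level<level-suc : ∀ j → level j < level (suc j)
level<level-suc j = <-≤-trans (n<2^n (level j)) (2^level≤level-suc j)

level-mono : ∀ {i j} → i ≤ j → level i ≤ level j
level-mono {j = zero} z≤n = ≤-refl
level-mono {i} {suc j} i≤1+j with m≤n⇒m<n∨m≡n i≤1+j
... | inj₁ (s≤s i≤j) = ≤-trans (level-mono i≤j) (<⇒≤ (level<level-suc j))
... | inj₂ refl      = ≤-refl

n≤level : ∀ j → j ≤ level j
n≤level zero    = z≤n
n≤level (suc j) = ≤-trans (s≤s (n≤level j)) (level<level-suc j)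

budget<horizon : ∀ j → budget j < horizon j
budget<horizon j = <-≤-trans (m<n+m (budget j) (s≤s z≤n)) (stretch-mono {K = exponent j} (inputLength≤stretch (task j)))
  where
  inputLength≤stretch : ∀ g → inputLengthFor g (level j) (exponent j) ≤ stretch (level j) (exponent j)
  inputLength≤stretch censusTask = n≤stretch (level j) (exponent j)
  inputLength≤stretch rankTask   = ≤-refl

∈-simQueries⇒length< : ∀ j O {s} → s ∈ simQueries j O → length s < level (suc j)
∈-simQueries⇒length< j O {s} s∈ = begin-strict
  length s                              ≤⟨ ∈-queries⇒length≤ O (machine j) (budget j) (initial j) s∈ ⟩
  tsize (qtape (initial j)) + budget j  ≡⟨ cong (λ t → tsize t + budget j) (initConfig-qtape (machine j) (ones (inputLength j))) ⟩
  suc (budget j)                        ≤⟨ budget<horizon j ⟩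
  horizon j                             <⟨ horizon<level-suc j ⟩
  level (suc j)                         ∎
  where open ≤-Reasoning

not-all-queried : ∀ j O → ¬ (strings (level j) ⊆ simQueries j O)
not-all-queried j O all-queried = <⇒≱ (<-trans (budget<horizon j) (horizon<2^level j)) (begin
  2 ^ level j                   ≡⟨ length-strings (level j) ⟨
  length (strings (level j))    ≤⟨ unique-⊆⇒length≤ (strings-unique (level j)) all-queried ⟩
  length (simQueries j O)       ≤⟨ length-queries (machine j) O (budget j) (initial j) ⟩
  budget j                      ∎)
  where open ≤-Reasoning

freshIn : List Str → List Str → Maybe Str
freshIn qs ws with any? (_∉? qs) ws
... | yes ∃∉ = just (proj₁ (find ∃∉))
... | no _   = nothing

freshIn-spec : ∀ qs ws → (∃ λ z → freshIn qs ws ≡ just z × z ∈ ws × z ∉ qs) ⊎ (ws ⊆ qs)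
freshIn-spec qs ws with any? (_∉? qs) ws
... | yes ∃∉ = let z , z∈ , z∉ = find ∃∉ in inj₁ (z , refl , z∈ , z∉)
... | no ∄∉  = inj₂ λ w∈ → decidable-stable (_ ∈? qs) (λ w∉ → ∄∉ (lose w∈ w∉))

unqueried : ℕ → Lang → Maybe Str
unqueried j O = freshIn (simQueries j O) (strings (level j))

data WitnessView (j : ℕ) (O : Lang) (w : Maybe Str) : Set where
  chosen  : ∀ z → answer j O ≡ baseline j O → w ≡ just z → z ∈ strings (level j) → z ∉ simQueries j O →
            WitnessView j O w
  skipped : answer j O ≢ baseline j O → w ≡ nothing → WitnessView j O w

opaque
  witness : ℕ → Lang → Maybe Str
  witness j O = if answer j O ℕ.≡ᵇ baseline j O then unqueried j O else nothing

  witness-view : ∀ j O → WitnessView j O (witness j O)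
  witness-view j O with answer j O ≟ baseline j O | freshIn-spec (simQueries j O) (strings (level j))
  ... | no a≢b  | _                           = skipped a≢b (cong (if_then unqueried j O else nothing) (≡ᵇ-false a≢b))
  ... | yes a≡b | inj₁ (z , fresh≡ , z∈ , z∉) =
    chosen z a≡b (trans (cong (if_then unqueried j O else nothing) (≡ᵇ-true a≡b)) fresh≡) z∈ z∉
  ... | yes _   | inj₂ all-queried            = ⊥-elim (not-all-queried j O all-queried)

singleton : Maybe Str → Lang
singleton nothing  _ = false
singleton (just z) x = does (x ≟ₛ z)

prefix : ℕ → Lang
prefix zero    x = false
prefix (suc j) x = prefix j x ∨ singleton (witness j (prefix j)) x

singleton-length : ∀ {j O x} → singleton (witness j O) x ≡ true → length x ≡ level j
singleton-length {j} {O} {x} hit with witness-view j O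
... | chosen z _ w≡ z∈ _ rewrite w≡ = trans (cong length (does-true (x ≟ₛ z) hit)) (∈-strings⇒length (level j) z∈)
... | skipped _ w≡      rewrite w≡ = case hit of λ ()

singleton-below : ∀ {j O x} → length x < level j → singleton (witness j O) x ≡ false
singleton-below {j} {O} {x} x< with singleton (witness j O) x in hit
... | true  = ⊥-elim (<-irrefl (singleton-length hit) x<)
... | false = refl

singleton-unqueried : ∀ {j O s} → s ∈ simQueries j O → singleton (witness j O) s ≡ false
singleton-unqueried {j} {O} {s} s∈ with witness-view j O
... | chosen z _ w≡ _ z∉ rewrite w≡ = dec-false (s ≟ₛ z) (λ s≡z → z∉ (subst (_∈ simQueries j O) s≡z s∈))
... | skipped _ w≡     rewrite w≡ = refl

prefix-length : ∀ j {x} → prefix j x ≡ true → length x < level j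
prefix-length (suc j) {x} hit with prefix j x in earlier
... | true  = <-trans (prefix-length j earlier) (level<level-suc j)
... | false = ≤-trans (≤-reflexive (cong suc (singleton-length hit))) (level<level-suc j)

prefix-above : ∀ j {x} → level j ≤ length x → prefix j x ≡ false
prefix-above j {x} level≤ with prefix j x in hit
... | true  = ⊥-elim (<⇒≱ (prefix-length j hit) level≤)
... | false = refl

prefix-stable : ∀ {i j x} → i ≤ j → length x < level i → prefix j x ≡ prefix i x
prefix-stable {i} {j} i≤j x< with m≤n⇒m<n∨m≡n i≤j
... | inj₂ refl = refl
prefix-stable {i} {suc j} {x} _ x< | inj₁ (s≤s i≤j) = begin
  prefix j x ∨ singleton (witness j (prefix j)) x  ≡⟨ cong (prefix j x ∨_) (singleton-below (<-≤-trans x< (level-mono i≤j))) ⟩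
  prefix j x ∨ false                               ≡⟨ Boolₚ.∨-identityʳ (prefix j x) ⟩
  prefix j x                                       ≡⟨ prefix-stable i≤j x< ⟩
  prefix i x                                       ∎
  where open ≡-Reasoning

-- level (suc (length x)) > length x, so no later stage adds x.
opaque
  D : Lang
  D x = prefix (suc (length x)) x

  D-below : ∀ j {x} → length x < level j → D x ≡ prefix j x
  D-below j {x} x< with ≤-total j (suc (length x))
  ... | inj₁ j≤ = prefix-stable j≤ x<
  ... | inj₂ ≥j = sym (prefix-stable ≥j (≤-trans (s≤s ≤-refl) (n≤level (suc (length x)))))

D-level : ∀ j {x} → length x ≤ level j → D x ≡ prefix j x ∨ singleton (witness j (prefix j)) x
D-level j x≤ = D-below (suc j) (≤-<-trans x≤ (level<level-suc j))

D-gap : ∀ j {x} → length x < level (suc j) → D x ≡ true → length x ≤ level j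
D-gap j {x} x< Dx with prefix j x in earlier
... | true  = <⇒≤ (prefix-length j earlier)
... | false = ≤-reflexive (singleton-length {j} {prefix j} {x}
                (trans (sym (cong (_∨ singleton (witness j (prefix j)) x) earlier)) (trans (sym (D-below (suc j) x<)) Dx)))

simulation-D : ∀ j → simulation j (prefix j) ≡ run D (machine j) (budget j) (initial j)
simulation-D j = run-agree (machine j) (prefix j) D (budget j) (initial j) agrees
  where
  agrees : ∀ {s} → s ∈ simQueries j (prefix j) → prefix j s ≡ D s
  agrees {s} s∈ = sym (begin
    D s                                               ≡⟨ D-below (suc j) (∈-simQueries⇒length< j (prefix j) s∈) ⟩
    prefix j s ∨ singleton (witness j (prefix j)) s   ≡⟨ cong (prefix j s ∨_) (singleton-unqueried s∈) ⟩
    prefix j s ∨ false                                ≡⟨ Boolₚ.∨-identityʳ (prefix j s) ⟩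
    prefix j s                                        ∎)
    where open ≡-Reasoning

-- Diagonalisation

answer-D : ∀ j {g y} → task j ≡ g → let n = inputLengthFor g (level j) (exponent j) in
           Outputs D (machine j) ((n + 2) ^ exponent j) (ones n) y → answer j (prefix j) ≡ unbin y
answer-D j refl (_ , out) = trans (cong (unbin ∘ outWord ∘ work) (simulation-D j)) (cong unbin out)

diagonal : ∀ j {R} → Unique R → strings (level j) ⊆ R →
           answer j (prefix j) ≢ baseline j (prefix j) + count (singleton (witness j (prefix j))) R
diagonal j {R} R! level⊆R with witness-view j (prefix j)
... | chosen z a≡b w≡ z∈ _ rewrite w≡ = λ a≡ → m+1+n≢m b (sym (begin
  b                                 ≡⟨ a≡b ⟨
  answer j (prefix j)               ≡⟨ a≡ ⟩
  b + count (λ x → does (x ≟ₛ z)) R ≡⟨ cong (b +_) (count-≟ₛ z R! (level⊆R z∈)) ⟩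
  b + 1                             ∎))
  where
  open ≡-Reasoning
  b = baseline j (prefix j)
... | skipped a≢b w≡ rewrite w≡ = λ a≡ → a≢b (trans a≡ (trans (cong (_ +_) (count-zero R (λ _ → refl))) (+-identityʳ _)))

census-diagonal : ∀ j → task j ≡ censusTask →
                  ¬ Outputs D (machine j) ((level j + 2) ^ exponent j) (ones (level j)) (bin (census D (level j)))
census-diagonal j census-j out = diagonal j (strings-unique (level j)) (λ z∈ → z∈) (begin
  answer j (prefix j)                        ≡⟨ answer-D j census-j out ⟩
  unbin (bin (census D (level j)))           ≡⟨ unbin-bin _ ⟩
  count D (strings (level j))                ≡⟨ count-cong (strings (level j)) D-at-level ⟩
  count added (strings (level j))            ≡⟨ cong (_+ count added (strings (level j))) baseline≡ ⟨
  baseline j (prefix j) + count added (strings (level j)) ∎)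
  where
  open ≡-Reasoning
  added = singleton (witness j (prefix j))
  baseline≡ : baseline j (prefix j) ≡ 0
  baseline≡ = cong (λ g → baselineFor g (level j) (prefix j)) census-j
  D-at-level : ∀ {x} → x ∈ strings (level j) → D x ≡ added x
  D-at-level {x} x∈ = trans (D-level j (≤-reflexive |x|≡)) (cong (_∨ added x) (prefix-above j (≤-reflexive (sym |x|≡))))
    where |x|≡ = ∈-strings⇒length (level j) x∈

rank-diagonal : ∀ j → task j ≡ rankTask → let L = stretch (level j) (exponent j) in
                ¬ Outputs D (machine j) ((L + 2) ^ exponent j) (ones L) (bin (count D (stringsUpTo (level j))))
rank-diagonal j rank-j out = diagonal j (stringsUpTo-unique (level j)) level⊆upTo (begin
  answer j (prefix j)                                 ≡⟨ answer-D j rank-j out ⟩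
  unbin (bin (count D upTo))                          ≡⟨ unbin-bin _ ⟩
  count D upTo                                        ≡⟨ count-cong upTo (D-level j ∘ ∈-stringsUpTo⇒length≤ (level j)) ⟩
  count (λ x → prefix j x ∨ added x) upTo             ≡⟨ count-∨ upTo (λ _ px → singleton-below (prefix-length j px)) ⟩
  count (prefix j) upTo + count added upTo            ≡⟨ cong (_+ count added upTo) baseline≡ ⟨
  baseline j (prefix j) + count added upTo            ∎)
  where
  open ≡-Reasoning
  upTo  = stringsUpTo (level j)
  added = singleton (witness j (prefix j))
  level⊆upTo : strings (level j) ⊆ upTo
  level⊆upTo z∈ = ∈-stringsUpTo (level j) (≤-reflexive (∈-strings⇒length (level j) z∈))
  baseline≡ : baseline j (prefix j) ≡ count (prefix j) upTo
  baseline≡ = cong (λ g → baselineFor g (level j) (prefix j)) rank-j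

count-bijection : ∀ {A B : Lang} {m n} (φ ψ : Str → Str) →
                  (∀ x → ψ (φ x) ≡ x) → (∀ y → φ (ψ y) ≡ y) → (∀ x → B (φ x) ≡ A x) →
                  (∀ x → length x ≤ m → A x ≡ true → length (φ x) ≤ n) →
                  (∀ y → length y ≤ n → B y ≡ true → length (ψ y) ≤ m) →
                  count A (stringsUpTo m) ≡ count B (stringsUpTo n)
count-bijection {A} {B} {m} {n} φ ψ ψ∘φ φ∘ψ B∘φ φ-short ψ-short = ≤-antisym
  (count-≤-injection {A} {B} φ (stringsUpTo-unique m) φ-injective
    (λ {x} x∈ Ax → ∈-stringsUpTo n (φ-short x (∈-stringsUpTo⇒length≤ m x∈) Ax) , trans (B∘φ x) Ax))
  (count-≤-injection {B} {A} ψ (stringsUpTo-unique n) ψ-injective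
    (λ {y} y∈ By → let A[ψy] = trans (sym (B∘φ (ψ y))) (trans (cong B (φ∘ψ y)) By) in
                   ∈-stringsUpTo m (ψ-short y (∈-stringsUpTo⇒length≤ n y∈) By) , A[ψy]))
  where
  φ-injective : ∀ {x x′} → φ x ≡ φ x′ → x ≡ x′
  φ-injective {x} {x′} eq = trans (sym (ψ∘φ x)) (trans (cong ψ eq) (ψ∘φ x′))
  ψ-injective : ∀ {y y′} → ψ y ≡ ψ y′ → y ≡ y′
  ψ-injective {y} {y′} eq = trans (sym (φ∘ψ y)) (trans (cong φ eq) (φ∘ψ y′))

rank-of-scaled : ∀ j {φ ψ B Mφ Mψ kφ kψ} →
                 ComputesInTime D Mφ kφ φ → ComputesInTime D Mψ kψ ψ → kφ ≤ exponent j → kψ ≤ exponent j →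
                 (∀ x → ψ (φ x) ≡ x) → (∀ y → φ (ψ y) ≡ y) → (∀ x → B (φ x) ≡ D x) →
                 rank B (ones (stretch (level j) (exponent j))) ≡ count D (stringsUpTo (level j))
rank-of-scaled j {φ} {ψ} {B} φ-time ψ-time kφ≤ kψ≤ ψ∘φ φ∘ψ B∘φ =
  trans (rank-ones B L) (sym (count-bijection φ ψ ψ∘φ φ∘ψ B∘φ φ-short ψ-short))
  where
  L = stretch (level j) (exponent j)
  φ-short : ∀ x → length x ≤ level j → D x ≡ true → length (φ x) ≤ L
  φ-short x x≤ _ = FP-length φ-time x≤ kφ≤
  ψ-short : ∀ y → length y ≤ L → B y ≡ true → length (ψ y) ≤ level j
  ψ-short y y≤ By = D-gap j (≤-<-trans (FP-length ψ-time y≤ kψ≤) (horizon<level-suc j))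
                             (trans (sym (B∘φ (ψ y))) (trans (cong B (φ∘ψ y)) By))

not-scalable : ¬ Scalable D D
not-scalable (φ , ψ , ((Mφ , kφ , φ-time) , (Mψ , kψ , ψ-time) , ψ∘φ , φ∘ψ) , B , B∘φ , (Mr , kr , rank-time))
  with enumerate Mr (kφ ⊔ kψ ⊔ kr) rankTask
... | j , ρ , K≡ , rank-j = rank-diagonal j rank-j (Outputs-relabel ρ {D} {(L + 2) ^ exponent j} {ones L} rank-output)
  where
  L = stretch (level j) (exponent j)
  ≤K : ∀ {k} → k ≤ kφ ⊔ kψ ⊔ kr → k ≤ exponent j
  ≤K = subst (_ ≤_) (sym K≡)
  rank≡ : rank B (ones L) ≡ count D (stringsUpTo (level j))
  rank≡ = rank-of-scaled j {φ} {ψ} {B} φ-time ψ-time (≤K (≤-trans (m≤m⊔n kφ kψ) (m≤m⊔n _ kr)))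
                                        (≤K (≤-trans (m≤n⊔m kφ kψ) (m≤m⊔n _ kr))) ψ∘φ φ∘ψ B∘φ
  rank-output : Outputs D Mr ((L + 2) ^ exponent j) (ones L) (bin (count D (stringsUpTo (level j))))
  rank-output = subst₂ (λ t y → Outputs D Mr t (ones L) y)
                       (cong (λ n → (n + 2) ^ exponent j) (length-ones L)) (cong bin rank≡)
                       (Outputs-mono {D} {Mr} {(length (ones L) + 2) ^ kr} {x = ones L}
                                     (poly-mono {length (ones L)} ≤-refl (≤K (m≤n⊔m _ kr))) (rank-time (ones L)))

census-not-in-FP : ¬ CensusInFP D D
census-not-in-FP (M , K , computes) with enumerate M K censusTask
... | j , ρ , refl , census-j =
  census-diagonal j census-j (Outputs-relabel ρ {D} {(level j + 2) ^ K} {ones (level j)} (computes (level j)))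

theorem5p4 : Σ Lang λ D → P D D × ¬ Scalable D D × ¬ CensusInFP D D
theorem5p4 = D , P-self D , not-scalable , census-not-in-FP
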